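{- For all $n\ge 1$, $\overline{q}_n(123,132,312)=\frac{1}{2}(n^2+3n-2)$.
   Context: For a positive integer $n$, let $\mathcal{S}_{n,n}$ denote the set of all permutations (words) $\pi=\pi_1\cdots\pi_{2n}$ of the multiset $\{1,1,2,2,\ldots,n,n\}$. A word $\pi$ contains a pattern $\sigma=\sigma_1\cdots\sigma_k$ if there are indices $i_1<\cdots<i_k$ such that $\pi_{i_a}=\pi_{i_b}$ iff $\sigma_a=\sigma_b$ and $\pi_{i_a}<\pi_{i_b}$ iff $\sigma_a<\sigma_b$ for all $a,b$; otherwise $\pi$ avoids $\sigma$. The quasi-Stirling permutations $\overline{\mathcal{Q}}_n$ are the $\pi\in\mathcal{S}_{n,n}$ avoiding both $1212$ and $2121$. For a set $\Lambda$ of patterns, $\overline{\mathcal{Q}}_n(\Lambda)$ is the set of $\pi\in\overline{\mathcal{Q}}_n$ avoiding every pattern in $\Lambda$, and $\overline{q}_n(\Lambda)=|\overline{\mathcal{Q}}_n(\Lambda)|$. -}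

module Defs where

open import Data.Bool using (Bool; true; false; _∧_; _∨_; not; if_then_else_)
open import Data.Nat using (ℕ; zero; suc; _+_; _*_; _≡ᵇ_; _<ᵇ_)
open import Data.List using (List; []; _∷_; map; concatMap; length; filter; upTo)
open import Data.Bool.ListAction using (all; any)
open import Data.Bool.Properties using (T?)

-- Words are lists of natural numbers.  Letters of a word in S_{n,n} are 1..n.

words : ℕ → ℕ → List (List ℕ)
words n zero    = [] ∷ []
words n (suc L) = concatMap (λ w → map (λ a → suc a ∷ w) (upTo n)) (words n L)

occ : ℕ → List ℕ → ℕ
occ k []      = 0
occ k (x ∷ w) = if k ≡ᵇ x then suc (occ k w) else occ k w

isMultiPerm : ℕ → List ℕ → Bool
isMultiPerm n w = (length w ≡ᵇ 2 * n) ∧ all (λ k → occ (suc k) w ≡ᵇ 2) (upTo n)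

-- all subsequences (choices of indices i_1 < ... < i_k), listed with repetition
subseqs : List ℕ → List (List ℕ)
subseqs []      = [] ∷ []
subseqs (x ∷ w) = map (x ∷_) (subseqs w) Data.List.++ subseqs w

-- i-th entry (0-based), default 0
at : List ℕ → ℕ → ℕ
at []      _       = 0
at (x ∷ _) zero    = x
at (_ ∷ w) (suc i) = at w i

_⇔ᵇ_ : Bool → Bool → Bool
a ⇔ᵇ b = if a then b else not b

orderIso : List ℕ → List ℕ → Bool
orderIso σ s =
  (length s ≡ᵇ length σ) ∧
  all (λ a → all (λ b →
         ((at s a ≡ᵇ at s b) ⇔ᵇ (at σ a ≡ᵇ at σ b)) ∧
         ((at s a <ᵇ at s b) ⇔ᵇ (at σ a <ᵇ at σ b)))
       (upTo (length σ)))
      (upTo (length σ))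

contains : List ℕ → List ℕ → Bool
contains π σ = any (orderIso σ) (subseqs π)

avoids : List ℕ → List ℕ → Bool
avoids π σ = not (contains π σ)

inQbar : ℕ → List (List ℕ) → List ℕ → Bool
inQbar n Λ π =
  isMultiPerm n π ∧ avoids π (1 ∷ 2 ∷ 1 ∷ 2 ∷ []) ∧ avoids π (2 ∷ 1 ∷ 2 ∷ 1 ∷ [])
  ∧ all (avoids π) Λ

-- q̄_n(Λ) = |Q̄_n(Λ)|, counted over the (duplicate-free) list of all words of length 2n
qbar : ℕ → List (List ℕ) → ℕ
qbar n Λ = length (filter (λ π → T? (inQbar n Λ π)) (words n (2 * n)))

-- Let c = n be the largest letter. A word w avoids 123, 132 and 312 exactly when deleting every c
-- leaves a weakly decreasing word: an ascent a < b of that word, together with one copy of c,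
-- would form one of the three patterns, and conversely in such a word every ascent ends in c.
-- So each π ∈ Q̄_n(123,132,312) is n−1 n−1 … 1 1 with the two copies of n inserted without
-- creating a crossing x y x y. With k = n − 1 there are k + 1 gaps between the blocks x x,
-- giving (k+1)(k+2)/2 insertions into gaps, and k further insertions x n n x inside a block;
-- any other placement splits a block and crosses it. In total (k² + 5k + 2)/2 = (n² + 3n − 2)/2.

module Submission where

open import Defs
open import Data.Nat using (ℕ; _+_; _*_; _∸_; _≤_)
open import Data.List using (List; []; _∷_)
open import Relation.Binary.PropositionalEquality using (_≡_)

open import Data.Bool using (Bool; true; false; not; _∧_; T; if_then_else_)
open import Data.Bool.Properties using (T-∧; T-≡; T?)
open import Data.Empty using (⊥-elim)
open import Data.Nat using (zero; suc; _<_; _>_; _≡ᵇ_; _<ᵇ_; s≤s; z<s; s<s)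
open import Data.Nat.Properties
  using ( suc-injective; +-suc; *-suc; _≟_; ≡ᵇ⇒≡; ≡⇒≡ᵇ; <ᵇ⇒<; <⇒<ᵇ; <-cmp
        ; ≤-refl; ≤-antisym; ≤-pred; <-irrefl; <-trans; <⇒≤; <⇒≢; >⇒≢; <⇒≯; <⇒≱
        ; ≮⇒≥; ≤∧≢⇒<; n<1+n; m<n⇒m<1+n; m<1+n⇒m<n∨m≡n )
open import Data.Nat.Tactic.RingSolver using (solve-∀)
open import Data.List using (_++_; map; length; upTo; concatMap; replicate; applyDownFrom; filter)
open import Data.List.Properties
  using (∷-injectiveˡ; ∷-injectiveʳ; length-map; length-++; length-applyDownFrom)
open import Data.List.Membership.Propositional using (_∈_; _∉_; find; lose)
open import Data.List.Membership.Propositional.Properties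
  using ( ∈-++⁺ˡ; ∈-++⁺ʳ; ∈-++⁻; ∈-map⁺; ∈-map⁻; ∈-upTo⁺; ∈-upTo⁻; ∈-concatMap⁺; ∈-concatMap⁻
        ; ∈-applyDownFrom⁺; ∈-applyDownFrom⁻; ∈-filter⁺; ∈-filter⁻ )
open import Data.List.Membership.Propositional.Properties.WithK using (unique∧set⇒bag)
open import Data.List.Relation.Unary.All as All using (All; []; _∷_)
open import Data.List.Relation.Unary.All.Properties using (all⁺; all⁻)
open import Data.List.Relation.Unary.Any using (here; there)
open import Data.List.Relation.Unary.Any.Properties using (any⁺; any⁻)
open import Data.List.Relation.Unary.AllPairs as AllPairs using (AllPairs; []; _∷_)
open import Data.List.Relation.Unary.AllPairs.Properties using (applyDownFrom⁺₁)
open import Data.List.Relation.Unary.Unique.Propositional using (Unique)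
import Data.List.Relation.Unary.Unique.Propositional.Properties as Unique
open import Data.List.Relation.Binary.BagAndSetEquality using (∼bag⇒↭)
open import Data.List.Relation.Binary.Permutation.Propositional.Properties using (↭-length)
open import Data.List.Relation.Binary.Sublist.Propositional
  using (_⊆_; []; _∷_; _∷ʳ_; ⊆-refl; ⊆-trans; to∈; from∈; minimum)
open import Data.List.Relation.Binary.Sublist.Propositional.Properties using (∷ˡ⁻; All-resp-⊆)
open import Data.Product as Product using (∃; ∃₂; _×_; _,_; proj₁; proj₂)
open import Data.Sum as Sum using (_⊎_; inj₁; inj₂)
open import Function using (_∘_; Equivalence; _⇔_; mk⇔)
open import Relation.Binary.Definitions using (tri<; tri≈; tri>)
open import Relation.Binary.PropositionalEquality
  using (_≢_; refl; sym; trans; cong; cong₂; subst; module ≡-Reasoning)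
open import Relation.Nullary using (¬_; Dec; yes; no)
open ≡-Reasoning

private
  variable
    m n : ℕ
    a b c x y z : ℕ
    s v w : List ℕ
    p q : Bool

T⇒≡true : T p → p ≡ true
T⇒≡true = Equivalence.to T-≡

¬T⇒≡false : ¬ T p → p ≡ false
¬T⇒≡false {false} _  = refl
¬T⇒≡false {true}  ¬t = ⊥-elim (¬t _)

T-∧⁺ : T p → T q → T (p ∧ q)
T-∧⁺ tp tq = Equivalence.from T-∧ (tp , tq)

T-not⁺ : ¬ T p → T (not p)
T-not⁺ {false} _  = _
T-not⁺ {true}  ¬t = ¬t _

T-not⁻ : T (not p) → ¬ T p
T-not⁻ {true} ()

T-⇔ᵇ : T (p ⇔ᵇ q) → p ≡ q
T-⇔ᵇ {true}  {true}  _ = refl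
T-⇔ᵇ {false} {false} _ = refl

≡ᵇ-refl : ∀ m → (m ≡ᵇ m) ≡ true
≡ᵇ-refl m = T⇒≡true (≡⇒≡ᵇ m m refl)

≡ᵇ-true⇒≡ : ∀ m n → (m ≡ᵇ n) ≡ true → m ≡ n
≡ᵇ-true⇒≡ m n e = ≡ᵇ⇒≡ m n (Equivalence.from T-≡ e)

≡ᵇ-false⇒≢ : ∀ m n → (m ≡ᵇ n) ≡ false → m ≢ n
≡ᵇ-false⇒≢ m n e m≡n = subst T e (≡⇒≡ᵇ m n m≡n)

≢⇒≡ᵇ-false : m ≢ n → (m ≡ᵇ n) ≡ false
≢⇒≡ᵇ-false {m} {n} m≢n = ¬T⇒≡false (m≢n ∘ ≡ᵇ⇒≡ m n)

<⇒<ᵇ-true : m < n → (m <ᵇ n) ≡ true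
<⇒<ᵇ-true = T⇒≡true ∘ <⇒<ᵇ

≮⇒<ᵇ-false : ¬ m < n → (m <ᵇ n) ≡ false
≮⇒<ᵇ-false {m} {n} m≮n = ¬T⇒≡false (m≮n ∘ <ᵇ⇒< m n)

<ᵇ-irrefl : ∀ m → (m <ᵇ m) ≡ false
<ᵇ-irrefl m = ≮⇒<ᵇ-false (<-irrefl {m} refl)

∈-subseqs⁺ : s ⊆ w → s ∈ subseqs w
∈-subseqs⁺ []                      = here refl
∈-subseqs⁺ {w = x ∷ w} (_ ∷ʳ s⊆w)  = ∈-++⁺ʳ (map (x ∷_) (subseqs w)) (∈-subseqs⁺ s⊆w)
∈-subseqs⁺ {w = x ∷ w} (refl ∷ s⊆w) = ∈-++⁺ˡ (∈-map⁺ (x ∷_) (∈-subseqs⁺ s⊆w))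

∈-subseqs⁻ : ∀ w → s ∈ subseqs w → s ⊆ w
∈-subseqs⁻ []      (here refl) = []
∈-subseqs⁻ (x ∷ w) s∈ with ∈-++⁻ (map (x ∷_) (subseqs w)) s∈
... | inj₂ s∈′ = x ∷ʳ ∈-subseqs⁻ w s∈′
... | inj₁ s∈′ with ∈-map⁻ (x ∷_) s∈′
...   | t , t∈ , refl = refl ∷ ∈-subseqs⁻ w t∈

contains⁺ : ∀ {π σ s} → s ⊆ π → T (orderIso σ s) → T (contains π σ)
contains⁺ {σ = σ} s⊆π iso = any⁺ (orderIso σ) (lose (∈-subseqs⁺ s⊆π) iso)

contains⁻ : ∀ {π σ} → T (contains π σ) → ∃ λ s → s ⊆ π × T (orderIso σ s)
contains⁻ {π} {σ} t with find (any⁻ (orderIso σ) (subseqs π) t)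
... | s , s∈ , iso = s , ∈-subseqs⁻ π s∈ , iso

avoids⁻ : ∀ {π σ s} → T (avoids π σ) → s ⊆ π → ¬ T (orderIso σ s)
avoids⁻ {π} {σ} av s⊆π iso = T-not⁻ av (contains⁺ {π} {σ} s⊆π iso)

avoids⁺ : ∀ {π σ} → (∀ {s} → s ⊆ π → ¬ T (orderIso σ s)) → T (avoids π σ)
avoids⁺ {π} {σ} none = T-not⁺ λ t → let _ , s⊆π , iso = contains⁻ {π} {σ} t in none s⊆π iso

orderIso-length : ∀ σ s → T (orderIso σ s) → length s ≡ length σ
orderIso-length σ s iso = ≡ᵇ⇒≡ _ _ (proj₁ (Equivalence.to (T-∧ {length s ≡ᵇ length σ}) iso))

orderIso-at : ∀ σ s → T (orderIso σ s) → ∀ {i j} → i < length σ → j < length σ →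
  (at s i ≡ᵇ at s j) ≡ (at σ i ≡ᵇ at σ j) × (at s i <ᵇ at s j) ≡ (at σ i <ᵇ at σ j)
orderIso-at σ s iso {i} {j} i< j< =
  let rows = proj₂ (Equivalence.to (T-∧ {length s ≡ᵇ length σ}) iso)
      row  = All.lookup (all⁺ _ (upTo (length σ)) rows) (∈-upTo⁺ i<)
      cell = All.lookup (all⁺ _ (upTo (length σ)) row) (∈-upTo⁺ j<)
      eq , lt = Equivalence.to (T-∧ {(at s i ≡ᵇ at s j) ⇔ᵇ (at σ i ≡ᵇ at σ j)}) cell
  in T-⇔ᵇ eq , T-⇔ᵇ lt

orderIso-≡ : ∀ σ s → T (orderIso σ s) → ∀ {i j} → i < length σ → j < length σ →
  T (at σ i ≡ᵇ at σ j) → at s i ≡ at s j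
orderIso-≡ σ s iso i< j< t = ≡ᵇ⇒≡ _ _ (subst T (sym (proj₁ (orderIso-at σ s iso i< j<))) t)

orderIso-< : ∀ σ s → T (orderIso σ s) → ∀ {i j} → i < length σ → j < length σ →
  T (at σ i <ᵇ at σ j) → at s i < at s j
orderIso-< σ s iso i< j< t = <ᵇ⇒< _ _ (subst T (sym (proj₂ (orderIso-at σ s iso i< j<))) t)

σ123 σ132 σ312 σ1212 σ2121 : List ℕ
σ123  = 1 ∷ 2 ∷ 3 ∷ []
σ132  = 1 ∷ 3 ∷ 2 ∷ []
σ312  = 3 ∷ 1 ∷ 2 ∷ []
σ1212 = 1 ∷ 2 ∷ 1 ∷ 2 ∷ []
σ2121 = 2 ∷ 1 ∷ 2 ∷ 1 ∷ []

length≡3 : ∀ s → length s ≡ 3 → ∃ λ (a : ℕ) → ∃₂ λ (b c : ℕ) → s ≡ a ∷ b ∷ c ∷ []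
length≡3 (a ∷ b ∷ c ∷ []) refl = a , b , c , refl

length≡4 : ∀ s → length s ≡ 4 → ∃₂ λ (a b : ℕ) → ∃₂ λ (c d : ℕ) → s ≡ a ∷ b ∷ c ∷ d ∷ []
length≡4 (a ∷ b ∷ c ∷ d ∷ []) refl = a , b , c , d , refl

orderIso-123⁻ : ∀ s → T (orderIso σ123 s) →
  ∃ λ (a : ℕ) → ∃₂ λ (b c : ℕ) → s ≡ a ∷ b ∷ c ∷ [] × a < b × b < c
orderIso-123⁻ s iso with length≡3 s (orderIso-length σ123 s iso)
... | a , b , c , refl =
  a , b , c , refl , orderIso-< σ123 (a ∷ b ∷ c ∷ []) iso z<s (s<s z<s) _
                   , orderIso-< σ123 (a ∷ b ∷ c ∷ []) iso (s<s z<s) (s<s (s<s z<s)) _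

orderIso-132⁻ : ∀ s → T (orderIso σ132 s) →
  ∃ λ (a : ℕ) → ∃₂ λ (b c : ℕ) → s ≡ a ∷ b ∷ c ∷ [] × a < c × c < b
orderIso-132⁻ s iso with length≡3 s (orderIso-length σ132 s iso)
... | a , b , c , refl =
  a , b , c , refl , orderIso-< σ132 (a ∷ b ∷ c ∷ []) iso z<s (s<s (s<s z<s)) _
                   , orderIso-< σ132 (a ∷ b ∷ c ∷ []) iso (s<s (s<s z<s)) (s<s z<s) _

orderIso-312⁻ : ∀ s → T (orderIso σ312 s) →
  ∃ λ (a : ℕ) → ∃₂ λ (b c : ℕ) → s ≡ a ∷ b ∷ c ∷ [] × b < c × c < a
orderIso-312⁻ s iso with length≡3 s (orderIso-length σ312 s iso)
... | a , b , c , refl =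
  a , b , c , refl , orderIso-< σ312 (a ∷ b ∷ c ∷ []) iso (s<s z<s) (s<s (s<s z<s)) _
                   , orderIso-< σ312 (a ∷ b ∷ c ∷ []) iso (s<s (s<s z<s)) z<s _

orderIso-1212⁻ : ∀ s → T (orderIso σ1212 s) → ∃₂ λ (a b : ℕ) → s ≡ a ∷ b ∷ a ∷ b ∷ [] × a ≢ b
orderIso-1212⁻ s iso with length≡4 s (orderIso-length σ1212 s iso)
... | a , b , c , d , refl
  with refl ← orderIso-≡ σ1212 (a ∷ b ∷ c ∷ d ∷ []) iso z<s (s<s (s<s z<s)) _
  with refl ← orderIso-≡ σ1212 (a ∷ b ∷ a ∷ d ∷ []) iso (s<s z<s) (s<s (s<s (s<s z<s))) _
  = a , b , refl , <⇒≢ (orderIso-< σ1212 (a ∷ b ∷ a ∷ b ∷ []) iso z<s (s<s z<s) _)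

orderIso-2121⁻ : ∀ s → T (orderIso σ2121 s) → ∃₂ λ (a b : ℕ) → s ≡ a ∷ b ∷ a ∷ b ∷ [] × a ≢ b
orderIso-2121⁻ s iso with length≡4 s (orderIso-length σ2121 s iso)
... | a , b , c , d , refl
  with refl ← orderIso-≡ σ2121 (a ∷ b ∷ c ∷ d ∷ []) iso z<s (s<s (s<s z<s)) _
  with refl ← orderIso-≡ σ2121 (a ∷ b ∷ a ∷ d ∷ []) iso (s<s z<s) (s<s (s<s (s<s z<s))) _
  = a , b , refl , >⇒≢ (orderIso-< σ2121 (a ∷ b ∷ a ∷ b ∷ []) iso (s<s z<s) z<s _)

orderIso-123⁺ : a < b → b < c → T (orderIso σ123 (a ∷ b ∷ c ∷ []))
orderIso-123⁺ {a} {b} {c} a<b b<c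
  rewrite ≡ᵇ-refl a | ≡ᵇ-refl b | ≡ᵇ-refl c | <ᵇ-irrefl a | <ᵇ-irrefl b | <ᵇ-irrefl c
        | ≢⇒≡ᵇ-false (<⇒≢ a<b) | ≢⇒≡ᵇ-false (<⇒≢ b<c) | ≢⇒≡ᵇ-false (<⇒≢ (<-trans a<b b<c))
        | ≢⇒≡ᵇ-false (>⇒≢ a<b) | ≢⇒≡ᵇ-false (>⇒≢ b<c) | ≢⇒≡ᵇ-false (>⇒≢ (<-trans a<b b<c))
        | <⇒<ᵇ-true a<b | <⇒<ᵇ-true b<c | <⇒<ᵇ-true (<-trans a<b b<c)
        | ≮⇒<ᵇ-false (<⇒≯ a<b) | ≮⇒<ᵇ-false (<⇒≯ b<c) | ≮⇒<ᵇ-false (<⇒≯ (<-trans a<b b<c)) = _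

orderIso-132⁺ : a < c → c < b → T (orderIso σ132 (a ∷ b ∷ c ∷ []))
orderIso-132⁺ {a} {b} {c} a<c c<b
  rewrite ≡ᵇ-refl a | ≡ᵇ-refl b | ≡ᵇ-refl c | <ᵇ-irrefl a | <ᵇ-irrefl b | <ᵇ-irrefl c
        | ≢⇒≡ᵇ-false (<⇒≢ a<c) | ≢⇒≡ᵇ-false (<⇒≢ c<b) | ≢⇒≡ᵇ-false (<⇒≢ (<-trans a<c c<b))
        | ≢⇒≡ᵇ-false (>⇒≢ a<c) | ≢⇒≡ᵇ-false (>⇒≢ c<b) | ≢⇒≡ᵇ-false (>⇒≢ (<-trans a<c c<b))
        | <⇒<ᵇ-true a<c | <⇒<ᵇ-true c<b | <⇒<ᵇ-true (<-trans a<c c<b)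
        | ≮⇒<ᵇ-false (<⇒≯ a<c) | ≮⇒<ᵇ-false (<⇒≯ c<b) | ≮⇒<ᵇ-false (<⇒≯ (<-trans a<c c<b)) = _

orderIso-312⁺ : b < c → c < a → T (orderIso σ312 (a ∷ b ∷ c ∷ []))
orderIso-312⁺ {a} {b} {c} b<c c<a
  rewrite ≡ᵇ-refl a | ≡ᵇ-refl b | ≡ᵇ-refl c | <ᵇ-irrefl a | <ᵇ-irrefl b | <ᵇ-irrefl c
        | ≢⇒≡ᵇ-false (<⇒≢ b<c) | ≢⇒≡ᵇ-false (<⇒≢ c<a) | ≢⇒≡ᵇ-false (<⇒≢ (<-trans b<c c<a))
        | ≢⇒≡ᵇ-false (>⇒≢ b<c) | ≢⇒≡ᵇ-false (>⇒≢ c<a) | ≢⇒≡ᵇ-false (>⇒≢ (<-trans b<c c<a))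
        | <⇒<ᵇ-true b<c | <⇒<ᵇ-true c<a | <⇒<ᵇ-true (<-trans b<c c<a)
        | ≮⇒<ᵇ-false (<⇒≯ b<c) | ≮⇒<ᵇ-false (<⇒≯ c<a) | ≮⇒<ᵇ-false (<⇒≯ (<-trans b<c c<a)) = _

orderIso-1212⁺ : a < b → T (orderIso σ1212 (a ∷ b ∷ a ∷ b ∷ []))
orderIso-1212⁺ {a} {b} a<b
  rewrite ≡ᵇ-refl a | ≡ᵇ-refl b | <ᵇ-irrefl a | <ᵇ-irrefl b
        | ≢⇒≡ᵇ-false (<⇒≢ a<b) | ≢⇒≡ᵇ-false (>⇒≢ a<b) | <⇒<ᵇ-true a<b | ≮⇒<ᵇ-false (<⇒≯ a<b) = _

orderIso-2121⁺ : b < a → T (orderIso σ2121 (a ∷ b ∷ a ∷ b ∷ []))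
orderIso-2121⁺ {a} {b} b<a
  rewrite ≡ᵇ-refl a | ≡ᵇ-refl b | <ᵇ-irrefl a | <ᵇ-irrefl b
        | ≢⇒≡ᵇ-false (<⇒≢ b<a) | ≢⇒≡ᵇ-false (>⇒≢ b<a) | <⇒<ᵇ-true b<a | ≮⇒<ᵇ-false (<⇒≯ b<a) = _

Letter : ℕ → ℕ → Set
Letter n x = 0 < x × x ≤ n

lower-letters : All (Letter (suc m)) w → suc m ∉ w → All (Letter m) w
lower-letters letters m∉w = All.tabulate λ x∈ →
  let 0<x , x≤1+m = All.lookup letters x∈ in 0<x , ≤-pred (≤∧≢⇒< x≤1+m λ { refl → m∉w x∈ })

∈-words⁻ : ∀ n L {w} → w ∈ words n L → length w ≡ L × All (Letter n) w
∈-words⁻ n zero    (here refl) = refl , []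
∈-words⁻ n (suc L) w∈ with find (∈-concatMap⁻ (λ t → map (λ a → suc a ∷ t) (upTo n)) {xs = words n L} w∈)
... | t , t∈ , w∈′ with ∈-map⁻ (λ a → suc a ∷ t) w∈′
...   | a , a∈ , refl =
  let len , letters = ∈-words⁻ n L t∈ in cong suc len , (z<s , ∈-upTo⁻ a∈) ∷ letters

∈-words⁺ : ∀ n L {w} → length w ≡ L → All (Letter n) w → w ∈ words n L
∈-words⁺ n zero    {[]}        refl []                = here refl
∈-words⁺ n (suc L) {suc a ∷ t} refl ((_ , a<n) ∷ letters) =
  ∈-concatMap⁺ (λ t → map (λ a → suc a ∷ t) (upTo n))
    (lose (∈-words⁺ n L refl letters) (∈-map⁺ (λ a → suc a ∷ t) (∈-upTo⁺ a<n)))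

words-unique : ∀ n L → Unique (words n L)
words-unique n zero    = [] ∷ []
words-unique n (suc L) = extend (words n L) (words-unique n L)
  where
  prefix : List ℕ → List (List ℕ)
  prefix t = map (λ a → suc a ∷ t) (upTo n)

  extend : ∀ ws → Unique ws → Unique (concatMap prefix ws)
  extend []       _           = []
  extend (w ∷ ws) (w∉ws ∷ u) =
    Unique.++⁺ (Unique.map⁺ (suc-injective ∘ ∷-injectiveˡ) (Unique.upTo⁺ n)) (extend ws u) disjoint
    where
    disjoint : ∀ {v} → ¬ (v ∈ prefix w × v ∈ concatMap prefix ws)
    disjoint (v∈ , v∈′) with ∈-map⁻ _ v∈ | find (∈-concatMap⁻ prefix {xs = ws} v∈′)
    ... | _ , _ , refl | t , t∈ , v∈t with ∈-map⁻ _ v∈t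
    ...   | _ , _ , refl = All.lookup w∉ws t∈ refl

deleteAll : ℕ → List ℕ → List ℕ
deleteAll c []      = []
deleteAll c (x ∷ w) = if c ≡ᵇ x then deleteAll c w else x ∷ deleteAll c w

deleteAll-⊆ : ∀ c w → deleteAll c w ⊆ w
deleteAll-⊆ c []      = []
deleteAll-⊆ c (x ∷ w) with c ≡ᵇ x
... | true  = x ∷ʳ deleteAll-⊆ c w
... | false = refl ∷ deleteAll-⊆ c w

∈-deleteAll⁻ : ∀ c w → y ∈ deleteAll c w → y ≢ c
∈-deleteAll⁻ c (x ∷ w) y∈ with c ≡ᵇ x in eq | y∈
... | true  | y∈′       = ∈-deleteAll⁻ c w y∈′
... | false | here refl  = ≡ᵇ-false⇒≢ c x eq ∘ sym
... | false | there y∈′ = ∈-deleteAll⁻ c w y∈′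

∈-deleteAll⁺ : ∀ c w → y ∈ w → y ≡ c ⊎ y ∈ deleteAll c w
∈-deleteAll⁺ c (x ∷ w) y∈ with c ≡ᵇ x in eq | y∈
... | true  | here refl  = inj₁ (sym (≡ᵇ-true⇒≡ c x eq))
... | true  | there y∈′ = ∈-deleteAll⁺ c w y∈′
... | false | here refl  = inj₂ (here refl)
... | false | there y∈′ with ∈-deleteAll⁺ c w y∈′
...   | inj₁ y≡c = inj₁ y≡c
...   | inj₂ y∈″ = inj₂ (there y∈″)

⊆-deleteAll : ∀ c {s} w → s ⊆ w → All (_≢ c) s → s ⊆ deleteAll c w
⊆-deleteAll c []      []            _            = []
⊆-deleteAll c (x ∷ w) s⊆w           s≢c with c ≡ᵇ x in eq | s⊆w | s≢c
... | true  | _ ∷ʳ s⊆w′   | s≢c′         = ⊆-deleteAll c w s⊆w′ s≢c′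
... | true  | refl ∷ _    | x≢c ∷ _      = ⊥-elim (x≢c (sym (≡ᵇ-true⇒≡ c x eq)))
... | false | _ ∷ʳ s⊆w′   | s≢c′         = x ∷ʳ ⊆-deleteAll c w s⊆w′ s≢c′
... | false | refl ∷ s⊆w′ | _ ∷ s≢c′    = refl ∷ ⊆-deleteAll c w s⊆w′ s≢c′

occ>0⇒∈ : ∀ c w → occ c w ≡ suc n → c ∈ w
occ>0⇒∈ c (x ∷ w) o with c ≡ᵇ x in eq
... | true  = here (≡ᵇ-true⇒≡ c x eq)
... | false = there (occ>0⇒∈ c w o)

occ≡0⇒∉ : ∀ c w → occ c w ≡ 0 → c ∉ w
occ≡0⇒∉ c (x ∷ w) o c∈ with c ≡ᵇ x in eq | o | c∈
... | false | o′ | here refl  = ≡ᵇ-false⇒≢ c c eq refl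
... | false | o′ | there c∈′ = occ≡0⇒∉ c w o′ c∈′

∉⇒occ≡0 : ∀ c w → c ∉ w → occ c w ≡ 0
∉⇒occ≡0 c []      _  = refl
∉⇒occ≡0 c (x ∷ w) c∉ with c ≡ᵇ x in eq
... | true  = ⊥-elim (c∉ (here (≡ᵇ-true⇒≡ c x eq)))
... | false = ∉⇒occ≡0 c w (c∉ ∘ there)

occ-∷-other : ∀ k x w → k ≢ x → occ k (x ∷ w) ≡ occ k w
occ-∷-other k x w k≢x rewrite ≢⇒≡ᵇ-false k≢x = refl

occ-deleteAll : ∀ {k} c w → k ≢ c → occ k (deleteAll c w) ≡ occ k w
occ-deleteAll c []      _   = refl
occ-deleteAll {k} c (x ∷ w) k≢c with c ≡ᵇ x in eq
... | true  with refl ← ≡ᵇ-true⇒≡ c x eq rewrite ≢⇒≡ᵇ-false k≢c = occ-deleteAll c w k≢c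
... | false with k ≡ᵇ x
...   | true  = cong suc (occ-deleteAll c w k≢c)
...   | false = occ-deleteAll c w k≢c

deleteAll-fresh : ∀ c w → occ c w ≡ 0 → deleteAll c w ≡ w
deleteAll-fresh c []      _ = refl
deleteAll-fresh c (x ∷ w) o with c ≡ᵇ x
... | false = cong (x ∷_) (deleteAll-fresh c w o)

length-deleteAll : ∀ c w → length w ≡ occ c w + length (deleteAll c w)
length-deleteAll c []      = refl
length-deleteAll c (x ∷ w) with c ≡ᵇ x
... | true  = cong suc (length-deleteAll c w)
... | false = trans (cong suc (length-deleteAll c w)) (sym (+-suc (occ c w) _))

data Peeled (c x : ℕ) (v : List ℕ) : List ℕ → Set where
  peeled : ∀ k {w} → x ≢ c → deleteAll c w ≡ v → Peeled c x v (replicate k c ++ x ∷ w)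

peel : ∀ c w → deleteAll c w ≡ x ∷ v → Peeled c x v w
peel c (y ∷ w) del with c ≡ᵇ y in eq
... | true with refl ← ≡ᵇ-true⇒≡ c y eq with peel c w del
...   | peeled k x≢c del′ = peeled (suc k) x≢c del′
peel c (y ∷ w) refl | false = peeled 0 (≡ᵇ-false⇒≢ c y eq ∘ sym) refl

occ-peeled : x ≢ c → ∀ k w → occ c (replicate k c ++ x ∷ w) ≡ k + occ c w
occ-peeled {c = c} x≢c zero    w rewrite ≢⇒≡ᵇ-false (x≢c ∘ sym) = refl
occ-peeled {c = c} x≢c (suc k) w rewrite ≡ᵇ-refl c = cong suc (occ-peeled x≢c k w)

occ-peeled₂ : x ≢ c → ∀ k l w → occ c (replicate k c ++ x ∷ replicate l c ++ x ∷ w) ≡ k + (l + occ c w)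
occ-peeled₂ x≢c k l w = trans (occ-peeled x≢c k _) (cong (k +_) (occ-peeled x≢c l w))

deleteAll≡[] : ∀ c w → deleteAll c w ≡ [] → occ c w ≡ n → w ≡ replicate n c
deleteAll≡[] c []      _   refl = refl
deleteAll≡[] c (y ∷ w) del o with c ≡ᵇ y in eq
... | true with refl ← ≡ᵇ-true⇒≡ c y eq | refl ← o = cong (c ∷_) (deleteAll≡[] c w del refl)
... | false with () ← del

-- Non-crossing words

NonCrossing : List ℕ → Set
NonCrossing w = ∀ {x y} → x ≢ y → ¬ (x ∷ y ∷ x ∷ y ∷ [] ⊆ w)

Unenclosed : ℕ → List ℕ → Set
Unenclosed z w = ∀ {y} → y ≢ z → ¬ (y ∷ z ∷ y ∷ [] ⊆ w)

⊆⇒∈₂ : x ∷ y ∷ s ⊆ w → y ∈ w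
⊆⇒∈₂ = to∈ ∘ ∷ˡ⁻

nonCrossing-⊆ : v ⊆ w → NonCrossing w → NonCrossing v
nonCrossing-⊆ v⊆w nc x≢y p = nc x≢y (⊆-trans p v⊆w)

nonCrossing-∷ : NonCrossing w → Unenclosed z w → NonCrossing (z ∷ w)
nonCrossing-∷ nc _  x≢y (_ ∷ʳ p)   = nc x≢y p
nonCrossing-∷ _  un x≢y (refl ∷ p) = un (x≢y ∘ sym) p

nonCrossing-∷∷ : x ∉ w → NonCrossing w → NonCrossing (x ∷ x ∷ w)
nonCrossing-∷∷ _   nc a≢b (_ ∷ʳ _ ∷ʳ p)     = nc a≢b p
nonCrossing-∷∷ x∉w _  _   (_ ∷ʳ refl ∷ p)   = x∉w (⊆⇒∈₂ p)
nonCrossing-∷∷ x∉w _  _   (refl ∷ _ ∷ʳ p)   = x∉w (⊆⇒∈₂ p)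
nonCrossing-∷∷ _   _  a≢b (refl ∷ refl ∷ _) = a≢b refl

∉⇒unenclosed : z ∉ w → Unenclosed z w
∉⇒unenclosed z∉w _ p = z∉w (⊆⇒∈₂ p)

unenclosed-∷-self : Unenclosed z w → Unenclosed z (z ∷ w)
unenclosed-∷-self un y≢z (_ ∷ʳ p)   = un y≢z p
unenclosed-∷-self _  y≢z (refl ∷ _) = y≢z refl

unenclosed-∷∷ : x ∉ w → Unenclosed z w → Unenclosed z (x ∷ x ∷ w)
unenclosed-∷∷ _   un y≢z (_ ∷ʳ _ ∷ʳ p)     = un y≢z p
unenclosed-∷∷ x∉w _  _   (_ ∷ʳ refl ∷ p)   = x∉w (⊆⇒∈₂ p)
unenclosed-∷∷ x∉w _  _   (refl ∷ _ ∷ʳ p)   = x∉w (⊆⇒∈₂ p)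
unenclosed-∷∷ _   _  y≢z (refl ∷ refl ∷ _) = y≢z refl

avoids⇒nonCrossing : T (avoids w σ1212) → T (avoids w σ2121) → NonCrossing w
avoids⇒nonCrossing av1212 av2121 {x} {y} x≢y p with <-cmp x y
... | tri< x<y _ _ = avoids⁻ {σ = σ1212} av1212 p (orderIso-1212⁺ x<y)
... | tri≈ _ x≡y _ = x≢y x≡y
... | tri> _ _ y<x = avoids⁻ {σ = σ2121} av2121 p (orderIso-2121⁺ y<x)

nonCrossing⇒avoids1212 : NonCrossing w → T (avoids w σ1212)
nonCrossing⇒avoids1212 {w} nc = avoids⁺ {σ = σ1212} no1212
  where
  no1212 : ∀ {s} → s ⊆ w → ¬ T (orderIso σ1212 s)
  no1212 {s} p iso with _ , _ , refl , a≢b ← orderIso-1212⁻ s iso = nc a≢b p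

nonCrossing⇒avoids2121 : NonCrossing w → T (avoids w σ2121)
nonCrossing⇒avoids2121 {w} nc = avoids⁺ {σ = σ2121} no2121
  where
  no2121 : ∀ {s} → s ⊆ w → ¬ T (orderIso σ2121 s)
  no2121 {s} p iso with _ , _ , refl , a≢b ← orderIso-2121⁻ s iso = nc a≢b p

-- Avoiding 123, 132 and 312

NonIncreasing : List ℕ → Set
NonIncreasing d = ∀ {a b} → a ∷ b ∷ [] ⊆ d → b ≤ a

insert-into-singleton : b ∷ [] ⊆ w → c ∈ w → c ≢ b → c ∷ b ∷ [] ⊆ w ⊎ b ∷ c ∷ [] ⊆ w
insert-into-singleton (_ ∷ʳ p)   (here refl) _   = inj₁ (refl ∷ p)
insert-into-singleton (y ∷ʳ p)   (there c∈)  c≢b = Sum.map (y ∷ʳ_) (y ∷ʳ_) (insert-into-singleton p c∈ c≢b)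
insert-into-singleton (refl ∷ p) (here refl) c≢b = ⊥-elim (c≢b refl)
insert-into-singleton (refl ∷ p) (there c∈)  _   = inj₂ (refl ∷ from∈ c∈)

insert-into-pair : a ∷ b ∷ [] ⊆ w → c ∈ w → c ≢ a → c ≢ b →
  c ∷ a ∷ b ∷ [] ⊆ w ⊎ a ∷ c ∷ b ∷ [] ⊆ w ⊎ a ∷ b ∷ c ∷ [] ⊆ w
insert-into-pair (_ ∷ʳ p)   (here refl) _   _   = inj₁ (refl ∷ p)
insert-into-pair (y ∷ʳ p)   (there c∈)  c≢a c≢b =
  Sum.map (y ∷ʳ_) (Sum.map (y ∷ʳ_) (y ∷ʳ_)) (insert-into-pair p c∈ c≢a c≢b)
insert-into-pair (refl ∷ p) (here refl) c≢a _   = ⊥-elim (c≢a refl)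
insert-into-pair (refl ∷ p) (there c∈)  _   c≢b =
  inj₂ (Sum.map (refl ∷_) (refl ∷_) (insert-into-singleton p c∈ c≢b))

avoids⇒deleteAll-nonIncreasing : ∀ c w → All (_≤ c) w → c ∈ w →
  T (avoids w σ123) → T (avoids w σ132) → T (avoids w σ312) → NonIncreasing (deleteAll c w)
avoids⇒deleteAll-nonIncreasing c w bound c∈w av123 av132 av312 {a} {b} p = ≮⇒≥ ascent-impossible
  where
  a≢c : a ≢ c
  a≢c = ∈-deleteAll⁻ c w (to∈ p)

  b≢c : b ≢ c
  b≢c = ∈-deleteAll⁻ c w (⊆⇒∈₂ p)

  b<c : b < c
  b<c = ≤∧≢⇒< (All.lookup bound (⊆⇒∈₂ (⊆-trans p (deleteAll-⊆ c w)))) b≢c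

  ascent-impossible : ¬ a < b
  ascent-impossible a<b with insert-into-pair (⊆-trans p (deleteAll-⊆ c w)) c∈w (a≢c ∘ sym) (b≢c ∘ sym)
  ... | inj₁ q        = avoids⁻ {σ = σ312} av312 q (orderIso-312⁺ a<b b<c)
  ... | inj₂ (inj₁ q) = avoids⁻ {σ = σ132} av132 q (orderIso-132⁺ a<b b<c)
  ... | inj₂ (inj₂ q) = avoids⁻ {σ = σ123} av123 q (orderIso-123⁺ a<b b<c)

ascent-ends-at : ∀ c w → All (_≤ c) w → NonIncreasing (deleteAll c w) →
  ∀ {a b} → a ∷ b ∷ [] ⊆ w → a < b → b ≡ c
ascent-ends-at c w bound ni {a} {b} p a<b with b ≟ c
... | yes b≡c = b≡c
... | no  b≢c = ⊥-elim (<⇒≱ a<b (ni (⊆-deleteAll c w p (a≢c ∷ b≢c ∷ []))))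
  where
  a≢c : a ≢ c
  a≢c refl = <⇒≱ a<b (All.lookup bound (⊆⇒∈₂ p))

deleteAll-nonIncreasing⇒avoids : ∀ c w → All (_≤ c) w → NonIncreasing (deleteAll c w) →
  T (avoids w σ123) × T (avoids w σ132) × T (avoids w σ312)
deleteAll-nonIncreasing⇒avoids c w bound ni =
  avoids⁺ {σ = σ123} no123 , avoids⁺ {σ = σ132} no132 , avoids⁺ {σ = σ312} no312
  where
  ascent : ∀ {a b} → a ∷ b ∷ [] ⊆ w → a < b → b ≡ c
  ascent = ascent-ends-at c w bound ni

  no123 : ∀ {s} → s ⊆ w → ¬ T (orderIso σ123 s)
  no123 {s} p iso with a , b , c′ , refl , a<b , b<c′ ← orderIso-123⁻ s iso
    with refl ← ascent (⊆-trans (refl ∷ refl ∷ _ ∷ʳ []) p) a<b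
    with refl ← ascent (⊆-trans (_ ∷ʳ refl ∷ refl ∷ []) p) b<c′ = <-irrefl refl b<c′

  no132 : ∀ {s} → s ⊆ w → ¬ T (orderIso σ132 s)
  no132 {s} p iso with a , b , c′ , refl , a<c′ , c′<b ← orderIso-132⁻ s iso
    with refl ← ascent (⊆-trans (refl ∷ _ ∷ʳ refl ∷ []) p) a<c′ = <⇒≱ c′<b (All.lookup bound (⊆⇒∈₂ p))

  no312 : ∀ {s} → s ⊆ w → ¬ T (orderIso σ312 s)
  no312 {s} p iso with a , b , c′ , refl , b<c′ , c′<a ← orderIso-312⁻ s iso
    with refl ← ascent (⊆-trans (_ ∷ʳ refl ∷ refl ∷ []) p) b<c′ = <⇒≱ c′<a (All.lookup bound (to∈ p))

nonIncreasing-head : ∀ {h t} → NonIncreasing (h ∷ t) → All (_≤ n) (h ∷ t) → n ∈ h ∷ t → h ≡ n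
nonIncreasing-head _  _         (here refl)  = refl
nonIncreasing-head ni (h≤n ∷ _) (there n∈t) = ≤-antisym h≤n (ni (refl ∷ from∈ n∈t))

nonIncreasing-occ : ∀ {d k} → NonIncreasing d → All (_≤ n) d → occ n d ≡ suc k →
  ∃ λ t → d ≡ n ∷ t × occ n t ≡ k
nonIncreasing-occ {n} {h ∷ t} ni bound o
  with refl ← nonIncreasing-head ni bound (occ>0⇒∈ n (h ∷ t) o) rewrite ≡ᵇ-refl h =
  t , refl , suc-injective o

doubled : List ℕ → List ℕ
doubled []       = []
doubled (x ∷ xs) = x ∷ x ∷ doubled xs

∈-doubled⁻ : ∀ xs → y ∈ doubled xs → y ∈ xs
∈-doubled⁻ (x ∷ xs) (here e)           = here e
∈-doubled⁻ (x ∷ xs) (there (here e))   = here e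
∈-doubled⁻ (x ∷ xs) (there (there y∈)) = there (∈-doubled⁻ xs y∈)

∉-doubled : ∀ {xs} → All (_< c) xs → c ∉ doubled xs
∉-doubled {xs = xs} c>xs c∈ = <-irrefl refl (All.lookup c>xs (∈-doubled⁻ xs c∈))

occ-doubled : ∀ {xs} → AllPairs _>_ xs → y ∈ xs → occ y (doubled xs) ≡ 2
occ-doubled {y} (y>xs ∷ _) (here refl) rewrite ≡ᵇ-refl y = cong (suc ∘ suc) (∉⇒occ≡0 y _ (∉-doubled y>xs))
occ-doubled {y} {x ∷ _} (x>xs ∷ dec) (there y∈) rewrite ≢⇒≡ᵇ-false (<⇒≢ (All.lookup x>xs y∈)) =
  occ-doubled dec y∈

length-doubled : ∀ xs → length (doubled xs) ≡ 2 * length xs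
length-doubled []       = refl
length-doubled (x ∷ xs) = trans (cong (2 +_) (length-doubled xs)) (sym (*-suc 2 (length xs)))

descending : ∀ m → AllPairs _>_ (applyDownFrom suc m)
descending m = applyDownFrom⁺₁ suc m λ j<i _ → s<s j<i

doubled-nonCrossing : ∀ {xs} → AllPairs _>_ xs → NonCrossing (doubled xs)
doubled-nonCrossing []           _ ()
doubled-nonCrossing (x>xs ∷ dec) = nonCrossing-∷∷ (∉-doubled x>xs) (doubled-nonCrossing dec)

doubled-nonIncreasing : ∀ {xs} → AllPairs _>_ xs → NonIncreasing (doubled xs)
doubled-nonIncreasing (x>xs ∷ dec) (refl ∷ refl ∷ _) = ≤-refl
doubled-nonIncreasing {x ∷ xs} (x>xs ∷ dec) (refl ∷ _ ∷ʳ p) = <⇒≤ (All.lookup x>xs (∈-doubled⁻ xs (to∈ p)))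
doubled-nonIncreasing {x ∷ xs} (x>xs ∷ dec) (_ ∷ʳ refl ∷ p) = <⇒≤ (All.lookup x>xs (∈-doubled⁻ xs (to∈ p)))
doubled-nonIncreasing (x>xs ∷ dec) (_ ∷ʳ _ ∷ʳ p)    = doubled-nonIncreasing dec p

nonIncreasing⇒doubled : ∀ m d → All (Letter m) d → NonIncreasing d → (∀ k → k < m → occ (suc k) d ≡ 2) →
  d ≡ doubled (applyDownFrom suc m)
nonIncreasing⇒doubled zero    []      _                  _  _     = refl
nonIncreasing⇒doubled zero    (_ ∷ _) ((0<h , h≤0) ∷ _)  _  _     = ⊥-elim (<⇒≱ 0<h h≤0)
nonIncreasing⇒doubled (suc m) d       letters            ni twice
  with t , refl , o₁ ← nonIncreasing-occ ni (All.map proj₂ letters) (twice m (n<1+n m))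
  with t′ , refl , o₀ ← nonIncreasing-occ (ni ∘ (suc m ∷ʳ_)) (All.map proj₂ (All.tail letters)) o₁ =
  cong (λ t → suc m ∷ suc m ∷ t)
    (nonIncreasing⇒doubled m t′ (lower-letters (All.tail (All.tail letters)) (occ≡0⇒∉ (suc m) t′ o₀))
      (ni ∘ (suc m ∷ʳ_) ∘ (suc m ∷ʳ_)) twice′)
  where
  twice′ : ∀ k → k < m → occ (suc k) t′ ≡ 2
  twice′ k k<m = begin
    occ (suc k) t′                    ≡⟨ occ-∷-other (suc k) (suc m) t′ k≢m ⟨
    occ (suc k) (suc m ∷ t′)          ≡⟨ occ-∷-other (suc k) (suc m) (suc m ∷ t′) k≢m ⟨
    occ (suc k) (suc m ∷ suc m ∷ t′)  ≡⟨ twice k (m<n⇒m<1+n k<m) ⟩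
    2                                 ∎
    where
    k≢m : suc k ≢ suc m
    k≢m = <⇒≢ (s<s k<m)

-- Inserting copies of the largest letter

-- Insert₁ c xs w: w is doubled xs with one c inserted at a boundary of the blocks x x.
-- Insert₂ c xs w: w is doubled xs with two copies of c inserted without creating a crossing.
data Insert₁ (c : ℕ) : List ℕ → List ℕ → Set where
  here  : ∀ {xs} → Insert₁ c xs (c ∷ doubled xs)
  there : ∀ {x xs w} → Insert₁ c xs w → Insert₁ c (x ∷ xs) (x ∷ x ∷ w)

data Insert₂ (c : ℕ) : List ℕ → List ℕ → Set where
  lead   : ∀ {xs w} → Insert₁ c xs w → Insert₂ c xs (c ∷ w)
  nested : ∀ {x xs} → Insert₂ c (x ∷ xs) (x ∷ c ∷ c ∷ x ∷ doubled xs)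
  there  : ∀ {x xs w} → Insert₂ c xs w → Insert₂ c (x ∷ xs) (x ∷ x ∷ w)

deleteAll≡doubled⇒insert₁ : ∀ xs w → deleteAll c w ≡ doubled xs → occ c w ≡ 1 → NonCrossing (c ∷ w) →
  Insert₁ c xs w
deleteAll≡doubled⇒insert₁ {c} [] w del o _ with refl ← deleteAll≡[] c w del o = here
deleteAll≡doubled⇒insert₁ {c} (x ∷ xs) w del o nc with peel c w del
... | peeled k {w₁} x≢c del₁ with peel c w₁ del₁
...   | peeled l {w₂} _ del₂ = split k l (trans (sym (occ-peeled₂ x≢c k l w₂)) o) nc
  where
  split : ∀ k l → k + (l + occ c w₂) ≡ 1 →
    NonCrossing (c ∷ replicate k c ++ x ∷ replicate l c ++ x ∷ w₂) →
    Insert₁ c (x ∷ xs) (replicate k c ++ x ∷ replicate l c ++ x ∷ w₂)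
  split 0 0 o nc =
    there (deleteAll≡doubled⇒insert₁ xs w₂ del₂ o (nonCrossing-⊆ (refl ∷ x ∷ʳ x ∷ʳ ⊆-refl) nc))
  split 0 1 _ nc = ⊥-elim (nc (x≢c ∘ sym) (refl ∷ refl ∷ refl ∷ refl ∷ minimum w₂))
  split 1 0 o _ with refl ← trans (sym (deleteAll-fresh c w₂ (suc-injective o))) del₂ = here
  split 0 (suc (suc _)) () _
  split 1 (suc _)       () _
  split (suc (suc _)) _ () _

deleteAll≡doubled⇒insert₂ : ∀ xs w → deleteAll c w ≡ doubled xs → occ c w ≡ 2 → NonCrossing w →
  Insert₂ c xs w
deleteAll≡doubled⇒insert₂ {c} [] w del o _ with refl ← deleteAll≡[] c w del o = lead here
deleteAll≡doubled⇒insert₂ {c} (x ∷ xs) w del o nc with peel c w del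
... | peeled k {w₁} x≢c del₁ with peel c w₁ del₁
...   | peeled l {w₂} _ del₂ = split k l (trans (sym (occ-peeled₂ x≢c k l w₂)) o) nc
  where
  w₂≡doubled : occ c w₂ ≡ 0 → w₂ ≡ doubled xs
  w₂≡doubled o₀ = trans (sym (deleteAll-fresh c w₂ o₀)) del₂

  split : ∀ k l → k + (l + occ c w₂) ≡ 2 →
    NonCrossing (replicate k c ++ x ∷ replicate l c ++ x ∷ w₂) →
    Insert₂ c (x ∷ xs) (replicate k c ++ x ∷ replicate l c ++ x ∷ w₂)
  split 0 0 o nc = there (deleteAll≡doubled⇒insert₂ xs w₂ del₂ o (nonCrossing-⊆ (x ∷ʳ x ∷ʳ ⊆-refl) nc))
  split 0 1 o nc = ⊥-elim (nc x≢c (refl ∷ refl ∷ refl ∷ from∈ (occ>0⇒∈ c w₂ (suc-injective o))))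
  split 0 2 o _ with refl ← w₂≡doubled (suc-injective (suc-injective o)) = nested
  split 1 0 o nc = lead (there (deleteAll≡doubled⇒insert₁ xs w₂ del₂ (suc-injective o)
                                  (nonCrossing-⊆ (refl ∷ x ∷ʳ x ∷ʳ ⊆-refl) nc)))
  split 1 1 _ nc = ⊥-elim (nc (x≢c ∘ sym) (refl ∷ refl ∷ refl ∷ refl ∷ minimum w₂))
  split 2 0 o _ with refl ← w₂≡doubled (suc-injective (suc-injective o)) = lead here
  split 0 (suc (suc (suc _))) () _
  split 1 (suc (suc _))       () _
  split 2 (suc _)             () _
  split (suc (suc (suc _))) _ () _

∈-insertion : ∀ {xs} → deleteAll c w ≡ doubled xs → y ∈ w → y ≡ c ⊎ y ∈ xs
∈-insertion {c} {w} {xs = xs} del y∈ = Sum.map₂ (∈-doubled⁻ xs ∘ subst (_ ∈_) del) (∈-deleteAll⁺ c w y∈)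

fresh-letter : ∀ {xs} → x < c → All (_< x) xs → deleteAll c w ≡ doubled xs → x ∉ w
fresh-letter x<c x>xs del x∈ with ∈-insertion del x∈
... | inj₁ x≡c  = <⇒≢ x<c x≡c
... | inj₂ x∈xs = <-irrefl refl (All.lookup x>xs x∈xs)

insert₁-deleteAll : ∀ {xs} → All (_< c) xs → Insert₁ c xs w → deleteAll c w ≡ doubled xs × occ c w ≡ 1
insert₁-deleteAll {c} c>xs here rewrite ≡ᵇ-refl c =
  let fresh = ∉⇒occ≡0 c _ (∉-doubled c>xs) in deleteAll-fresh c _ fresh , cong suc fresh
insert₁-deleteAll {c} (x<c ∷ c>xs) (there {x} ins) rewrite ≢⇒≡ᵇ-false (>⇒≢ x<c) =
  Product.map₁ (cong (λ t → x ∷ x ∷ t)) (insert₁-deleteAll c>xs ins)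

insert₂-deleteAll : ∀ {xs} → All (_< c) xs → Insert₂ c xs w → deleteAll c w ≡ doubled xs × occ c w ≡ 2
insert₂-deleteAll {c} c>xs (lead ins) rewrite ≡ᵇ-refl c =
  Product.map₂ (cong suc) (insert₁-deleteAll c>xs ins)
insert₂-deleteAll {c} (x<c ∷ c>xs) (nested {x}) rewrite ≡ᵇ-refl c | ≢⇒≡ᵇ-false (>⇒≢ x<c) =
  let fresh = ∉⇒occ≡0 c _ (∉-doubled c>xs)
  in cong (λ t → x ∷ x ∷ t) (deleteAll-fresh c _ fresh) , cong (suc ∘ suc) fresh
insert₂-deleteAll {c} (x<c ∷ c>xs) (there {x} ins) rewrite ≢⇒≡ᵇ-false (>⇒≢ x<c) =
  Product.map₁ (cong (λ t → x ∷ x ∷ t)) (insert₂-deleteAll c>xs ins)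

insert₁-nonCrossing : ∀ {xs} → AllPairs _>_ (c ∷ xs) → Insert₁ c xs w → NonCrossing w × Unenclosed c w
insert₁-nonCrossing {c} (c>xs ∷ dec) (here {xs}) =
  nonCrossing-∷ (doubled-nonCrossing dec) (∉⇒unenclosed c∉) , unenclosed-∷-self (∉⇒unenclosed c∉)
  where
  c∉ : c ∉ doubled xs
  c∉ = ∉-doubled c>xs
insert₁-nonCrossing ((x<c ∷ c>xs) ∷ x>xs ∷ dec) (there ins) =
  let nc , un = insert₁-nonCrossing (c>xs ∷ dec) ins
      x∉ = fresh-letter x<c x>xs (proj₁ (insert₁-deleteAll c>xs ins))
  in nonCrossing-∷∷ x∉ nc , unenclosed-∷∷ x∉ un

insert₂-nonCrossing : ∀ {xs} → AllPairs _>_ (c ∷ xs) → Insert₂ c xs w → NonCrossing w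
insert₂-nonCrossing dec (lead ins) = let nc , un = insert₁-nonCrossing dec ins in nonCrossing-∷ nc un
insert₂-nonCrossing {c} ((x<c ∷ c>xs) ∷ x>xs ∷ dec) (nested {x} {xs}) =
  nonCrossing-∷ (nonCrossing-∷∷ c∉ (nonCrossing-∷ (doubled-nonCrossing dec) (∉⇒unenclosed x∉)))
                (unenclosed-∷∷ c∉ (unenclosed-∷-self (∉⇒unenclosed x∉)))
  where
  x∉ : x ∉ doubled xs
  x∉ = ∉-doubled x>xs

  c∉ : c ∉ x ∷ doubled xs
  c∉ (here c≡x) = >⇒≢ x<c c≡x
  c∉ (there c∈) = ∉-doubled c>xs c∈
insert₂-nonCrossing ((x<c ∷ c>xs) ∷ x>xs ∷ dec) (there ins) =
  nonCrossing-∷∷ (fresh-letter x<c x>xs (proj₁ (insert₂-deleteAll c>xs ins)))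
                 (insert₂-nonCrossing (c>xs ∷ dec) ins)

-- The characterisation of Q̄ₙ(123,132,312)

Λ₃ : List (List ℕ)
Λ₃ = σ123 ∷ σ132 ∷ σ312 ∷ []

-- The letters of w are not recorded: they are bounded by the enumeration `words`.
record InQbar (n : ℕ) (w : List ℕ) : Set where
  field
    length≡2n   : length w ≡ 2 * n
    twice       : ∀ k → k < n → occ (suc k) w ≡ 2
    nonCrossing : NonCrossing w
    avoids123   : T (avoids w σ123)
    avoids132   : T (avoids w σ132)
    avoids312   : T (avoids w σ312)

T-inQbar⁻ : T (inQbar n Λ₃ w) → InQbar n w
T-inQbar⁻ {n} {w} t =
  let multiPerm , t₁ = Equivalence.to T-∧ t
      length≡ , twice = Equivalence.to (T-∧ {length w ≡ᵇ 2 * n}) multiPerm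
      av1212 , t₂     = Equivalence.to T-∧ t₁
      av2121 , t₃     = Equivalence.to T-∧ t₂
      av123 , t₄      = Equivalence.to T-∧ t₃
      av132 , t₅      = Equivalence.to T-∧ t₄
      av312 , _       = Equivalence.to T-∧ t₅
  in record
    { length≡2n   = ≡ᵇ⇒≡ _ _ length≡
    ; twice       = λ k k<n → ≡ᵇ⇒≡ _ _ (All.lookup (all⁺ _ (upTo n) twice) (∈-upTo⁺ k<n))
    ; nonCrossing = avoids⇒nonCrossing av1212 av2121
    ; avoids123   = av123
    ; avoids132   = av132
    ; avoids312   = av312
    }

T-inQbar⁺ : InQbar n w → T (inQbar n Λ₃ w)
T-inQbar⁺ {n} q =
  T-∧⁺ (T-∧⁺ (≡⇒≡ᵇ _ _ length≡2n) (all⁻ _ (All.tabulate λ k∈ → ≡⇒≡ᵇ _ _ (twice _ (∈-upTo⁻ k∈)))))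
       (T-∧⁺ (nonCrossing⇒avoids1212 nonCrossing)
       (T-∧⁺ (nonCrossing⇒avoids2121 nonCrossing)
       (T-∧⁺ avoids123 (T-∧⁺ avoids132 (T-∧⁺ avoids312 _)))))
  where open InQbar q

inQbar⇒insert₂ : ∀ m w → All (Letter (suc m)) w → InQbar (suc m) w → Insert₂ (suc m) (applyDownFrom suc m) w
inQbar⇒insert₂ m w letters q =
  deleteAll≡doubled⇒insert₂ (applyDownFrom suc m) w remainder twice-max nonCrossing
  where
  open InQbar q

  max : ℕ
  max = suc m

  twice-max : occ max w ≡ 2
  twice-max = twice m (n<1+n m)

  remainder : deleteAll max w ≡ doubled (applyDownFrom suc m)
  remainder = nonIncreasing⇒doubled m (deleteAll max w)
    (lower-letters (All-resp-⊆ (deleteAll-⊆ max w) letters) (λ max∈ → ∈-deleteAll⁻ max w max∈ refl))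
    (avoids⇒deleteAll-nonIncreasing max w (All.map proj₂ letters) (occ>0⇒∈ max w twice-max)
      avoids123 avoids132 avoids312)
    (λ k k<m → trans (occ-deleteAll max w (<⇒≢ (s<s k<m))) (twice k (m<n⇒m<1+n k<m)))

insert₂⇒inQbar : ∀ m w → Insert₂ (suc m) (applyDownFrom suc m) w → All (Letter (suc m)) w × InQbar (suc m) w
insert₂⇒inQbar m w ins = letters , record
  { length≡2n   = length≡2n
  ; twice       = twice
  ; nonCrossing = insert₂-nonCrossing (descending (suc m)) ins
  ; avoids123   = proj₁ avoidance
  ; avoids132   = proj₁ (proj₂ avoidance)
  ; avoids312   = proj₂ (proj₂ avoidance)
  }
  where
  max : ℕ
  max = suc m

  xs : List ℕ
  xs = applyDownFrom suc m

  max>xs : All (_< max) xs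
  max>xs = AllPairs.head (descending max)

  xs-descending : AllPairs _>_ xs
  xs-descending = AllPairs.tail (descending max)

  remainder : deleteAll max w ≡ doubled xs
  remainder = proj₁ (insert₂-deleteAll max>xs ins)

  twice-max : occ max w ≡ 2
  twice-max = proj₂ (insert₂-deleteAll max>xs ins)

  letters : All (Letter max) w
  letters = All.tabulate λ y∈ → letter (∈-insertion remainder y∈)
    where
    letter : y ≡ max ⊎ y ∈ xs → Letter max y
    letter (inj₁ refl) = z<s , ≤-refl
    letter (inj₂ y∈xs) with i , i<m , refl ← ∈-applyDownFrom⁻ suc y∈xs = z<s , s≤s (<⇒≤ i<m)

  length≡2n : length w ≡ 2 * max
  length≡2n = begin
    length w                              ≡⟨ length-deleteAll max w ⟩
    occ max w + length (deleteAll max w)  ≡⟨ cong₂ (λ k d → k + length d) twice-max remainder ⟩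
    2 + length (doubled xs)               ≡⟨ cong (2 +_) (length-doubled xs) ⟩
    2 + 2 * length xs                     ≡⟨ cong (λ k → 2 + 2 * k) (length-applyDownFrom suc m) ⟩
    2 + 2 * m                             ≡⟨ *-suc 2 m ⟨
    2 * max                               ∎

  twice : ∀ k → k < max → occ (suc k) w ≡ 2
  twice k k<max with m<1+n⇒m<n∨m≡n k<max
  ... | inj₂ refl = twice-max
  ... | inj₁ k<m  = begin
    occ (suc k) w                  ≡⟨ occ-deleteAll max w (<⇒≢ (s<s k<m)) ⟨
    occ (suc k) (deleteAll max w)  ≡⟨ cong (occ (suc k)) remainder ⟩
    occ (suc k) (doubled xs)       ≡⟨ occ-doubled xs-descending (∈-applyDownFrom⁺ suc k<m) ⟩
    2                              ∎

  avoidance : T (avoids w σ123) × T (avoids w σ132) × T (avoids w σ312)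
  avoidance = deleteAll-nonIncreasing⇒avoids max w (All.map proj₂ letters)
    (subst NonIncreasing (sym remainder) (doubled-nonIncreasing xs-descending))

-- Counting

insertions₁ : ℕ → List ℕ → List (List ℕ)
insertions₁ c []       = (c ∷ []) ∷ []
insertions₁ c (x ∷ xs) = (c ∷ x ∷ x ∷ doubled xs) ∷ map (λ w → x ∷ x ∷ w) (insertions₁ c xs)

insertions₂ : ℕ → List ℕ → List (List ℕ)
insertions₂ c []       = (c ∷ c ∷ []) ∷ []
insertions₂ c (x ∷ xs) =
  map (c ∷_) (insertions₁ c (x ∷ xs)) ++
  (x ∷ c ∷ c ∷ x ∷ doubled xs) ∷ map (λ w → x ∷ x ∷ w) (insertions₂ c xs)

∈-insertions₁⁺ : ∀ {xs} → Insert₁ c xs w → w ∈ insertions₁ c xs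
∈-insertions₁⁺ {xs = []}    here      = here refl
∈-insertions₁⁺ {xs = _ ∷ _} here      = here refl
∈-insertions₁⁺ (there {x = x} ins)    = there (∈-map⁺ (λ w → x ∷ x ∷ w) (∈-insertions₁⁺ ins))

∈-insertions₁⁻ : ∀ xs → w ∈ insertions₁ c xs → Insert₁ c xs w
∈-insertions₁⁻ []       (here refl) = here
∈-insertions₁⁻ (x ∷ xs) (here refl) = here
∈-insertions₁⁻ (x ∷ xs) (there w∈) with ∈-map⁻ (λ w → x ∷ x ∷ w) w∈
... | _ , w∈′ , refl = there (∈-insertions₁⁻ xs w∈′)

∈-insertions₂⁺ : ∀ {xs} → Insert₂ c xs w → w ∈ insertions₂ c xs
∈-insertions₂⁺ {xs = []}    (lead here) = here refl
∈-insertions₂⁺ {xs = _ ∷ _} (lead ins)  = ∈-++⁺ˡ (∈-map⁺ (_ ∷_) (∈-insertions₁⁺ ins))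
∈-insertions₂⁺ {c = c} (nested {x} {xs}) =
  ∈-++⁺ʳ (map (c ∷_) (insertions₁ c (x ∷ xs))) (here refl)
∈-insertions₂⁺ {c = c} (there {x} {xs} ins) =
  ∈-++⁺ʳ (map (c ∷_) (insertions₁ c (x ∷ xs))) (there (∈-map⁺ (λ w → x ∷ x ∷ w) (∈-insertions₂⁺ ins)))

∈-insertions₂⁻ : ∀ xs → w ∈ insertions₂ c xs → Insert₂ c xs w
∈-insertions₂⁻ []       (here refl) = lead here
∈-insertions₂⁻ {c = c} (x ∷ xs) w∈ with ∈-++⁻ (map (c ∷_) (insertions₁ c (x ∷ xs))) w∈
... | inj₁ w∈₁ with ∈-map⁻ (c ∷_) w∈₁
...   | _ , w∈′ , refl = lead (∈-insertions₁⁻ (x ∷ xs) w∈′)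
∈-insertions₂⁻ (x ∷ xs) w∈ | inj₂ (here refl) = nested
∈-insertions₂⁻ (x ∷ xs) w∈ | inj₂ (there w∈₂) with ∈-map⁻ (λ w → x ∷ x ∷ w) w∈₂
... | _ , w∈′ , refl = there (∈-insertions₂⁻ xs w∈′)

insertions₁-unique : ∀ {xs} → All (_< c) xs → Unique (insertions₁ c xs)
insertions₁-unique {xs = []}     _            = [] ∷ []
insertions₁-unique {c} {x ∷ xs} (x<c ∷ c>xs) =
  All.tabulate head≢ ∷ Unique.map⁺ (∷-injectiveʳ ∘ ∷-injectiveʳ) (insertions₁-unique c>xs)
  where
  head≢ : v ∈ map (λ w → x ∷ x ∷ w) (insertions₁ c xs) → c ∷ x ∷ x ∷ doubled xs ≢ v
  head≢ v∈ eq with _ , _ , refl ← ∈-map⁻ (λ w → x ∷ x ∷ w) v∈ = >⇒≢ x<c (∷-injectiveˡ eq)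

insertions₂-unique : ∀ {xs} → All (_< c) xs → Unique (insertions₂ c xs)
insertions₂-unique {xs = []}     _            = [] ∷ []
insertions₂-unique {c} {x ∷ xs} (x<c ∷ c>xs) =
  Unique.++⁺ (Unique.map⁺ ∷-injectiveʳ (insertions₁-unique (x<c ∷ c>xs)))
             (All.tabulate nested≢ ∷ Unique.map⁺ (∷-injectiveʳ ∘ ∷-injectiveʳ) (insertions₂-unique c>xs))
             disjoint
  where
  later : List (List ℕ)
  later = map (λ w → x ∷ x ∷ w) (insertions₂ c xs)

  nested≢ : v ∈ later → x ∷ c ∷ c ∷ x ∷ doubled xs ≢ v
  nested≢ v∈ eq with _ , _ , refl ← ∈-map⁻ (λ w → x ∷ x ∷ w) v∈ = >⇒≢ x<c (∷-injectiveˡ (∷-injectiveʳ eq))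

  starts-with-x : v ∈ (x ∷ c ∷ c ∷ x ∷ doubled xs) ∷ later → ∃ λ t → v ≡ x ∷ t
  starts-with-x (here refl) = _ , refl
  starts-with-x (there v∈) with _ , _ , refl ← ∈-map⁻ (λ w → x ∷ x ∷ w) v∈ = _ , refl

  disjoint : ¬ (v ∈ map (c ∷_) (insertions₁ c (x ∷ xs)) × v ∈ (x ∷ c ∷ c ∷ x ∷ doubled xs) ∷ later)
  disjoint (v∈₁ , v∈₂) with _ , _ , refl ← ∈-map⁻ (c ∷_) v∈₁ | _ , eq ← starts-with-x v∈₂ =
    >⇒≢ x<c (∷-injectiveˡ eq)

length-insertions₁ : ∀ c xs → length (insertions₁ c xs) ≡ suc (length xs)
length-insertions₁ c []       = refl
length-insertions₁ c (x ∷ xs) =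
  cong suc (trans (length-map (λ w → x ∷ x ∷ w) (insertions₁ c xs)) (length-insertions₁ c xs))

twice-length-insertions₂ : ∀ c xs → let k = length xs in 2 * length (insertions₂ c xs) ≡ k * k + 5 * k + 2
twice-length-insertions₂ c []       = refl
twice-length-insertions₂ c (x ∷ xs) = begin
  2 * length (insertions₂ c (x ∷ xs))
    ≡⟨ cong (2 *_) (length-++ (map (c ∷_) (insertions₁ c (x ∷ xs)))) ⟩
  2 * (length (map (c ∷_) (insertions₁ c (x ∷ xs))) + length ((x ∷ c ∷ c ∷ x ∷ doubled xs) ∷ later))
    ≡⟨ cong₂ (λ a b → 2 * (a + suc b))
         (trans (length-map (c ∷_) (insertions₁ c (x ∷ xs))) (length-insertions₁ c (x ∷ xs)))
         (length-map (λ w → x ∷ x ∷ w) (insertions₂ c xs)) ⟩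
  2 * (suc (suc k) + suc L)        ≡⟨ regroup k L ⟩
  2 * L + (2 * k + 6)              ≡⟨ cong (_+ (2 * k + 6)) (twice-length-insertions₂ c xs) ⟩
  k * k + 5 * k + 2 + (2 * k + 6)  ≡⟨ shift k ⟩
  suc k * suc k + 5 * suc k + 2    ∎
  where
  k L : ℕ
  k = length xs
  L = length (insertions₂ c xs)
  later : List (List ℕ)
  later = map (λ w → x ∷ x ∷ w) (insertions₂ c xs)

  regroup : ∀ k L → 2 * (suc (suc k) + suc L) ≡ 2 * L + (2 * k + 6)
  regroup = solve-∀

  shift : ∀ k → k * k + 5 * k + 2 + (2 * k + 6) ≡ suc k * suc k + 5 * suc k + 2
  shift = solve-∀

unique-length : ∀ {A : Set} {xs ys : List A} → Unique xs → Unique ys → (∀ {v} → v ∈ xs ⇔ v ∈ ys) →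
  length xs ≡ length ys
unique-length uxs uys same = ↭-length (∼bag⇒↭ (unique∧set⇒bag uxs uys same))

qbar≡length-insertions₂ : ∀ m → qbar (suc m) Λ₃ ≡ length (insertions₂ (suc m) (applyDownFrom suc m))
qbar≡length-insertions₂ m =
  unique-length (Unique.filter⁺ inQbar? (words-unique (suc m) (2 * suc m)))
                (insertions₂-unique (AllPairs.head (descending (suc m))))
                (mk⇔ to from)
  where
  inQbar? : (π : List ℕ) → Dec (T (inQbar (suc m) Λ₃ π))
  inQbar? π = T? (inQbar (suc m) Λ₃ π)

  to : w ∈ filter inQbar? (words (suc m) (2 * suc m)) → w ∈ insertions₂ (suc m) (applyDownFrom suc m)
  to {w} w∈ =
    let w∈words , t = ∈-filter⁻ inQbar? {xs = words (suc m) (2 * suc m)} w∈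
    in ∈-insertions₂⁺ (inQbar⇒insert₂ m w (proj₂ (∈-words⁻ (suc m) (2 * suc m) w∈words)) (T-inQbar⁻ t))

  from : w ∈ insertions₂ (suc m) (applyDownFrom suc m) → w ∈ filter inQbar? (words (suc m) (2 * suc m))
  from {w} w∈ =
    let letters , q = insert₂⇒inQbar m w (∈-insertions₂⁻ (applyDownFrom suc m) w∈)
    in ∈-filter⁺ inQbar? (∈-words⁺ (suc m) (2 * suc m) (InQbar.length≡2n q) letters) (T-inQbar⁺ q)

theorem4p13 : (n : ℕ) → 1 ≤ n →
    2 * qbar n ((1 ∷ 2 ∷ 3 ∷ []) ∷ (1 ∷ 3 ∷ 2 ∷ []) ∷ (3 ∷ 1 ∷ 2 ∷ []) ∷ []) ≡ n * n + 3 * n ∸ 2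
theorem4p13 (suc m) _ = begin
  2 * qbar (suc m) Λ₃
    ≡⟨ cong (2 *_) (qbar≡length-insertions₂ m) ⟩
  2 * length (insertions₂ (suc m) (applyDownFrom suc m))
    ≡⟨ twice-length-insertions₂ (suc m) (applyDownFrom suc m) ⟩
  k * k + 5 * k + 2
    ≡⟨ cong (λ k → k * k + 5 * k + 2) (length-applyDownFrom suc m) ⟩
  m * m + 5 * m + 2
    ≡⟨ cong (_∸ 2) (shift m) ⟩
  suc m * suc m + 3 * suc m ∸ 2
    ∎
  where
  k : ℕ
  k = length (applyDownFrom suc m)

  -- The truncated subtraction disappears by computation: (2 + t) ∸ 2 reduces to t.
  shift : ∀ m → 2 + (m * m + 5 * m + 2) ≡ suc m * suc m + 3 * suc m
  shift = solve-∀
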